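{- There exist connected graphs $G$ and $H$ such that $H$ is a spanning subgraph of $G$ and $src^\ell(G)>src^\ell(H)$.
   Context: All graphs are finite, simple and undirected. An edge-coloured path is rainbow if all its edges have distinct colours; a geodesic is a shortest path between its endpoints. An (not necessarily proper) edge-colouring of a connected graph is strongly rainbow connected if any two vertices are joined by a rainbow geodesic. An $r$-edge-list assignment of $G$ assigns to each edge $e$ a set $L(e)\subset\mathbb N$ with $|L(e)|\ge r$; an $L$-edge-colouring is an edge-colouring $c$ with $c(e)\in L(e)$ for all $e$. $src^\ell(G)$ is the minimum integer $r$ such that for every $r$-edge-list assignment $L$ of $G$ there exists a strongly rainbow connected $L$-edge-colouring of $G$. -}

module Defs where

open import Data.Nat using (ℕ; suc; _≤_; _<_)
open import Data.Bool using (Bool; true; false)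
open import Data.Fin using (Fin) renaming (_<_ to _<ᶠ_)
open import Data.Fin.Properties using (<-cmp)
open import Data.List using (List; []; _∷_; map)
open import Data.List.Relation.Unary.Unique.Propositional using (Unique)
open import Data.Product using (Σ; ∃; _×_; _,_)
open import Data.Empty using (⊥; ⊥-elim)
open import Function.Definitions using (Injective)
open import Relation.Binary.PropositionalEquality using (_≡_; refl; subst; sym; trans)
open import Relation.Binary.Definitions using (tri<; tri≈; tri>)

record Graph (n : ℕ) : Set where
  field
    adj    : Fin n → Fin n → Bool
    adj-sym    : ∀ u v → adj u v ≡ adj v u
    adj-irrefl : ∀ u → adj u u ≡ false
open Graph public

Adj : ∀ {n} → Graph n → Fin n → Fin n → Set
Adj G u v = adj G u v ≡ true

-- An (undirected) edge, represented canonically as an ordered pair u < v.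
Edge : ∀ {n} → Graph n → Set
Edge {n} G = Σ (Fin n) λ u → Σ (Fin n) λ v → (u <ᶠ v) × Adj G u v

edgeOf : ∀ {n} (G : Graph n) (u v : Fin n) → Adj G u v → Edge G
edgeOf G u v p with <-cmp u v
... | tri< u<v _ _ = u , v , u<v , p
... | tri≈ _ refl _ = ⊥-elim (f (trans (sym (adj-irrefl G u)) p))
  where
  f : false ≡ true → _
  f ()
... | tri> _ _ v<u = v , u , v<u , trans (adj-sym G v u) p

data Walk {n} (G : Graph n) : Fin n → Fin n → Set where
  here : ∀ {u} → Walk G u u
  step : ∀ {u w v} → Adj G u w → Walk G w v → Walk G u v

vertices : ∀ {n} {G : Graph n} {u v} → Walk G u v → List (Fin n)
vertices {u = u} here = u ∷ []
vertices {u = u} (step _ w) = u ∷ vertices w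

len : ∀ {n} {G : Graph n} {u v} → Walk G u v → ℕ
len here = 0
len (step _ w) = suc (len w)

edges : ∀ {n} {G : Graph n} {u v} → Walk G u v → List (Edge G)
edges here = []
edges {G = G} {u = u} (step {w = w} p q) = edgeOf G u w p ∷ edges q

IsPath : ∀ {n} {G : Graph n} {u v} → Walk G u v → Set
IsPath w = Unique (vertices w)

IsGeodesic : ∀ {n} {G : Graph n} {u v} → Walk G u v → Set
IsGeodesic {G = G} {u} {v} w =
  IsPath w × (∀ (q : Walk G u v) → IsPath q → len w ≤ len q)

Connected : ∀ {n} → Graph n → Set
Connected {n} G = ∀ (u v : Fin n) → Walk G u v

SpanningSubgraph : ∀ {n} → Graph n → Graph n → Set
SpanningSubgraph {n} H G = ∀ (u v : Fin n) → Adj H u v → Adj G u v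

-- (Not necessarily proper) edge-colourings with colours in ℕ.
EdgeColouring : ∀ {n} → Graph n → Set
EdgeColouring G = Edge G → ℕ

colours : ∀ {n} {G : Graph n} {u v} → EdgeColouring G → Walk G u v → List ℕ
colours c w = map c (edges w)

IsRainbow : ∀ {n} {G : Graph n} {u v} → EdgeColouring G → Walk G u v → Set
IsRainbow c w = Unique (colours c w)

StronglyRainbowConnected : ∀ {n} (G : Graph n) → EdgeColouring G → Set
StronglyRainbowConnected {n} G c =
  ∀ (u v : Fin n) → Σ (Walk G u v) λ w → IsGeodesic w × IsRainbow c w

ListAssignment : ∀ {n} → Graph n → Set₁
ListAssignment G = Edge G → ℕ → Set

HasAtLeast : ℕ → (ℕ → Set) → Set
HasAtLeast r S = Σ (Fin r → ℕ) λ f → Injective _≡_ _≡_ f × (∀ i → S (f i))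

IsRListAssignment : ∀ {n} (G : Graph n) → ℕ → ListAssignment G → Set
IsRListAssignment G r L = ∀ (e : Edge G) → HasAtLeast r (L e)

IsLColouring : ∀ {n} (G : Graph n) → ListAssignment G → EdgeColouring G → Set
IsLColouring G L c = ∀ (e : Edge G) → L e (c e)

ListSRC : ∀ {n} → Graph n → ℕ → Set₁
ListSRC G r = ∀ (L : ListAssignment G) → IsRListAssignment G r L →
  Σ (EdgeColouring G) λ c → IsLColouring G L c × StronglyRainbowConnected G c

IsSrcℓ : ∀ {n} → Graph n → ℕ → Set₁
IsSrcℓ G k = ListSRC G k × (∀ r → r < k → ListSRC G r → ⊥)

{-# OPTIONS --safe #-}
module Submission where

-- G has vertices 0,…,7 and edges 02 14 27 35 37 46 47 56 57 67; H is G without 37.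
--
-- Upper bounds: fix one geodesic for every ordered pair of vertices and say that two edges
-- conflict when they lie on a common fixed geodesic. Any colouring giving distinct colours
-- to conflicting edges is strongly rainbow connected, and if every edge conflicts with fewer
-- than r edges later in some ordering, colouring greedily from the back of that ordering
-- succeeds from any r-lists.
--
-- Lower bounds: if every u–v geodesic uses both e and f, then e and f get distinct colours
-- in every strongly rainbow connected colouring. The edges 02 14 27 37 47 of G (resp.
-- 02 14 27 35 of H) are pairwise of this kind, so with every list equal to {0,…,r−1} and
-- r < 5 (resp. r < 4) no good colouring exists, by pigeonhole.
--
-- The geodesics are found by search, and all finite conditions are decided by computation.

open import Defs
open import Data.Nat
  using (ℕ; zero; suc; _<_; _≤_; s≤s; _≤?_; _<?_) renaming (_≟_ to _≟ℕ_)
open import Data.Nat.Properties using (≤-trans; ≤-reflexive; n<1+n)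
open import Data.Bool using (true; false)
import Data.Bool.Properties as Bool
open import Data.Fin using (Fin; toℕ; fromℕ<; #_) renaming (_<?_ to _<ᶠ?_)
open import Data.Fin.Properties
  using ( _≟_; all?; any?; pigeonhole; toℕ-injective; toℕ<n; fromℕ<-injective
        ; <-cmp; <-irrelevant; <⇒≢)
open import Data.List
  using ( List; []; _∷_; length; lookup; map; filter; mapMaybe; cartesianProduct
        ; allFin; upTo; reverse; head)
open import Data.List.Properties using (length-map)
open import Data.List.Membership.Propositional using (_∈_; _∉_)
open import Data.List.Membership.Propositional.Properties
  using (∈-map⁺; ∈-filter⁺; ∈-allFin; ∈-cartesianProduct⁺)
open import Data.List.Membership.DecPropositional _≟ℕ_ using () renaming (_∈?_ to _∈ℕ?_)
import Data.List.Relation.Unary.All as All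
open import Data.List.Relation.Unary.All.Properties using () renaming (map⁺ to all-map⁺)
open import Data.List.Relation.Unary.AllPairs using ([]; _∷_)
open import Data.List.Relation.Unary.Any as Any using (Any; here; there)
open import Data.List.Relation.Unary.Any.Properties using (lookup-index; mapMaybe⁺; reverse⁺)
open import Data.List.Relation.Unary.Unique.Propositional using (Unique)
import Data.List.Relation.Unary.Unique.DecPropositional as UniqueDec
open import Data.Vec as Vec using ([]; _∷_)
open import Data.Maybe using (Maybe; just; nothing; Is-just)
import Data.Maybe as Maybe
import Data.Maybe.Relation.Unary.Any as MaybeAny
open import Data.Product as Product using (Σ; ∃; ∃₂; _×_; _,_; proj₁; proj₂)
open import Data.Product.Properties using (≡-dec)
open import Data.Sum as Sum using (_⊎_; inj₁; inj₂)
open import Data.Unit using (⊤; tt)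
open import Data.Empty using (⊥-elim)
open import Function using (_∘_)
open import Function.Definitions using (Injective)
open import Function.Bundles using (mk⇔)
open import Axiom.UniquenessOfIdentityProofs using (module Decidable⇒UIP)
open import Level using (0ℓ)
open import Relation.Binary.Core using (Rel)
open import Relation.Binary.Definitions
  using (DecidableEquality; Decidable; Symmetric; tri<; tri≈; tri>)
open import Relation.Binary.PropositionalEquality
  using (_≡_; _≢_; refl; sym; trans; cong; cong₂; subst; ≢-sym; module ≡-Reasoning)
open import Relation.Nullary using (¬_; Dec; yes; no; does)
open import Relation.Nullary.Decidable
  using ( map′; _×-dec_; _⊎-dec_; _→-dec_; ¬?; True; toWitness; from-yes
        ; decidable-stable; dec-false; does-⇔)

private
  variable
    n m r : ℕ

module _ {A B : Set} {f : A → B} where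

  unique-map⁺ : ∀ {xs} → (∀ {x y} → x ∈ xs → y ∈ xs → x ≢ y → f x ≢ f y) →
                Unique xs → Unique (map f xs)
  unique-map⁺ {[]}     _   []         = []
  unique-map⁺ {x ∷ xs} sep (x∉ ∷ uniq) =
    all-map⁺ (All.tabulate λ y∈ → sep (here refl) (there y∈) (All.lookup x∉ y∈)) ∷
    unique-map⁺ (λ x∈ y∈ → sep (there x∈) (there y∈)) uniq

  unique-map⇒injective : ∀ {xs x y} → Unique (map f xs) →
                         x ∈ xs → y ∈ xs → f x ≡ f y → x ≡ y
  unique-map⇒injective {_ ∷ _} _            (here refl) (here refl) _   = refl
  unique-map⇒injective {_ ∷ _} (fx∉ ∷ _)    (here refl) (there y∈)  eq  =
    ⊥-elim (All.lookup fx∉ (∈-map⁺ f y∈) eq)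
  unique-map⇒injective {_ ∷ _} (fy∉ ∷ _)    (there x∈)  (here refl) eq  =
    ⊥-elim (All.lookup fy∉ (∈-map⁺ f x∈) (sym eq))
  unique-map⇒injective {_ ∷ _} (_ ∷ uniq)   (there x∈)  (there y∈)  eq  =
    unique-map⇒injective uniq x∈ y∈ eq

¬injection-into-shorter-list : ∀ {A : Set} {f : Fin r → A} → Injective _≡_ _≡_ f →
                               (xs : List A) → length xs < r → ¬ (∀ i → f i ∈ xs)
¬injection-into-shorter-list {f = f} f-inj xs |xs|<r in-xs
  with i , j , i<j , same ← pigeonhole |xs|<r (Any.index ∘ in-xs)
  = <⇒≢ i<j (f-inj (begin
      f i                            ≡⟨ lookup-index (in-xs i) ⟩
      lookup xs (Any.index (in-xs i)) ≡⟨ cong (lookup xs) same ⟩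
      lookup xs (Any.index (in-xs j)) ≡⟨ lookup-index (in-xs j) ⟨
      f j                            ∎))
  where open ≡-Reasoning

CoOccur : ∀ {A : Set} → List (List A) → Rel A 0ℓ
CoOccur xss x y = Any (λ xs → x ∈ xs × y ∈ xs) xss

coOccur-sym : ∀ {A : Set} (xss : List (List A)) → Symmetric (CoOccur xss)
coOccur-sym _ = Any.map Product.swap

coOccur? : ∀ {A : Set} → DecidableEquality A → (xss : List (List A)) →
           Decidable (CoOccur xss)
coOccur? _≟ᴬ_ xss x y = Any.any? (λ xs → (x ∈? xs) ×-dec (y ∈? xs)) xss
  where open import Data.List.Membership.DecPropositional _≟ᴬ_ using (_∈?_)

fresh : ∀ {S : ℕ → Set} → HasAtLeast r S → (F : List ℕ) → length F < r →
        ∃ λ k → S k × k ∉ F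
fresh (f , f-inj , f∈S) F |F|<r with any? (λ i → ¬? (f i ∈ℕ? F))
... | yes (i , fi∉F) = f i , f∈S i , fi∉F
... | no none = ⊥-elim (¬injection-into-shorter-list f-inj F |F|<r λ i →
                  decidable-stable (f i ∈ℕ? F) (λ fi∉F → none (i , fi∉F)))

module GreedyListColouring {A : Set} (_≟ᴬ_ : DecidableEquality A)
  {R : Rel A 0ℓ} (R? : Decidable R) (R-sym : Symmetric R) where

  Degenerate : ℕ → List A → Set
  Degenerate r []       = ⊤
  Degenerate r (x ∷ xs) = length (filter (R? x) xs) < r × Degenerate r xs

  degenerate? : ∀ r xs → Dec (Degenerate r xs)
  degenerate? r []       = yes tt
  degenerate? r (x ∷ xs) = (length (filter (R? x) xs) <? r) ×-dec degenerate? r xs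

  record ProperListColouring (L : A → ℕ → Set) (xs : List A) : Set where
    field
      colour : A → ℕ
      from-lists : ∀ {x} → x ∈ xs → L x (colour x)
      proper : ∀ {x y} → x ∈ xs → y ∈ xs → x ≢ y → R x y → colour x ≢ colour y

  choosable : (L : A → ℕ → Set) → (∀ x → HasAtLeast r (L x)) →
              ∀ xs → Degenerate r xs → ProperListColouring L xs
  choosable L _ [] _ = record { colour = λ _ → 0 ; from-lists = λ () ; proper = λ () }
  choosable {r} L L-size (x ∷ xs) (few , deg) = record
    { colour = colour′ ; from-lists = from-lists′ ; proper = proper′ }
    where
    open ProperListColouring (choosable L L-size xs deg)

    forbidden : List ℕ
    forbidden = map colour (filter (R? x) xs)

    new : ∃ λ k → L x k × k ∉ forbidden
    new = fresh (L-size x) forbidden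
                (subst (_< r) (sym (length-map colour (filter (R? x) xs))) few)

    k : ℕ
    k = proj₁ new

    avoids : ∀ {y} → y ∈ xs → R x y → k ≢ colour y
    avoids y∈ xRy k≡ = proj₂ (proj₂ new)
      (subst (_∈ forbidden) (sym k≡) (∈-map⁺ colour (∈-filter⁺ (R? x) y∈ xRy)))

    colour′ : A → ℕ
    colour′ y with y ≟ᴬ x
    ... | yes _ = k
    ... | no  _ = colour y

    from-lists′ : ∀ {y} → y ∈ x ∷ xs → L y (colour′ y)
    from-lists′ {y} y∈ with y ≟ᴬ x
    ... | yes refl = proj₁ (proj₂ new)
    ... | no  y≢x  = from-lists (Any.tail y≢x y∈)

    proper′ : ∀ {y z} → y ∈ x ∷ xs → z ∈ x ∷ xs → y ≢ z → R y z →
              colour′ y ≢ colour′ z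
    proper′ {y} {z} y∈ z∈ y≢z yRz with y ≟ᴬ x | z ≟ᴬ x
    ... | yes refl | yes refl = ⊥-elim (y≢z refl)
    ... | yes refl | no  z≢x  = avoids (Any.tail z≢x z∈) yRz
    ... | no  y≢x  | yes refl = ≢-sym (avoids (Any.tail y≢x y∈) (R-sym yRz))
    ... | no  y≢x  | no  z≢x  = proper (Any.tail y≢x y∈) (Any.tail z≢x z∈) y≢z yRz

module _ {n} (G : Graph n) where

  ends : Edge G → Fin n × Fin n
  ends (u , v , _) = u , v

  ends-injective : Injective _≡_ _≡_ ends
  ends-injective {u , v , u<v , uv} {_ , _ , u<v′ , uv′} refl =
    cong₂ (λ lt a → u , v , lt , a)
      (<-irrelevant u<v u<v′) (Decidable⇒UIP.≡-irrelevant Bool._≟_ uv uv′)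

  _≟ᴱ_ : DecidableEquality (Edge G)
  e ≟ᴱ f = map′ ends-injective (cong ends) (≡-dec _≟_ _≟_ (ends e) (ends f))

  no-loop : ∀ {u} → ¬ Adj G u u
  no-loop {u} uu with () ← trans (sym (adj-irrefl G u)) uu

  edgeOf-ends : ∀ u x (ux : Adj G u x) →
                ends (edgeOf G u x ux) ≡ (u , x) ⊎ ends (edgeOf G u x ux) ≡ (x , u)
  edgeOf-ends u x ux with <-cmp u x
  ... | tri< _ _ _    = inj₁ refl
  ... | tri≈ _ refl _ = ⊥-elim (no-loop ux)
  ... | tri> _ _ _    = inj₂ refl

  start-∈-vertices : ∀ {u v} (w : Walk G u v) → u ∈ vertices w
  start-∈-vertices here       = here refl
  start-∈-vertices (step _ _) = here refl

  ends-∈-vertices : ∀ {u v e} (w : Walk G u v) → e ∈ edges w →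
                    proj₁ (ends e) ∈ vertices w × proj₂ (ends e) ∈ vertices w
  ends-∈-vertices (step {u} {x} ux w) (here refl) =
    both-∈ (edgeOf-ends u x ux) (here refl) (there (start-∈-vertices w))
    where
    both-∈ : ∀ {p : Fin n × Fin n} {xs} → p ≡ (u , x) ⊎ p ≡ (x , u) →
             u ∈ xs → x ∈ xs → proj₁ p ∈ xs × proj₂ p ∈ xs
    both-∈ (inj₁ refl) u∈ x∈ = u∈ , x∈
    both-∈ (inj₂ refl) u∈ x∈ = x∈ , u∈
  ends-∈-vertices (step _ w) (there e∈) = Product.map there there (ends-∈-vertices w e∈)

  source-∈-vertices : ∀ {u x a b} (ux : Adj G u x) (w : Walk G a b) →
                      edgeOf G u x ux ∈ edges w → u ∈ vertices w
  source-∈-vertices {u} {x} ux w e∈ with edgeOf-ends u x ux | ends-∈-vertices w e∈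
  ... | inj₁ eq | u∈ , _ = subst (_∈ vertices w) (cong proj₁ eq) u∈
  ... | inj₂ eq | _ , u∈ = subst (_∈ vertices w) (cong proj₂ eq) u∈

  path⇒edges-unique : ∀ {u v} (w : Walk G u v) → IsPath w → Unique (edges w)
  path⇒edges-unique here       _            = []
  path⇒edges-unique (step ux w) (u∉w ∷ path) =
    All.tabulate (λ e∈ eq →
      All.lookup u∉w (source-∈-vertices ux w (subst (_∈ edges w) (sym eq) e∈)) refl) ∷
    path⇒edges-unique w path

  toEdge : Fin n × Fin n → Maybe (Edge G)
  toEdge (u , v) with u <ᶠ? v | adj G u v Bool.≟ true
  ... | yes u<v | yes uv = just (u , v , u<v , uv)
  ... | _       | _      = nothing

  toEdge-ends : ∀ e → toEdge (ends e) ≡ just e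
  toEdge-ends (u , v , u<v , uv) with u <ᶠ? v | adj G u v Bool.≟ true
  ... | yes _    | yes _   = cong just (ends-injective refl)
  ... | no u≮v   | _       = ⊥-elim (u≮v u<v)
  ... | yes _    | no ¬uv  = ⊥-elim (¬uv uv)

  edgeList : List (Edge G)
  edgeList = mapMaybe toEdge (cartesianProduct (allFin n) (allFin n))

  ∈-edgeList : ∀ e → e ∈ edgeList
  ∈-edgeList e = mapMaybe⁺ toEdge _
    (Any.map (λ { refl → subst (MaybeAny.Any (e ≡_)) (sym (toEdge-ends e)) (MaybeAny.just refl) })
      (∈-map⁺ toEdge (∈-cartesianProduct⁺ (∈-allFin _) (∈-allFin _))))

  Lipschitz : (Fin n → Fin n → ℕ) → Set
  Lipschitz d = (∀ v → d v v ≡ 0) × (∀ u x v → Adj G u x → d u v ≤ suc (d x v))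

  lipschitz? : ∀ d → Dec (Lipschitz d)
  lipschitz? d = all? (λ v → d v v ≟ℕ 0) ×-dec
    all? λ u → all? λ x → all? λ v → (adj G u x Bool.≟ true) →-dec (d u v ≤? suc (d x v))

  lipschitz⇒≤-len : ∀ {d u v} → Lipschitz d → (w : Walk G u v) → d u v ≤ len w
  lipschitz⇒≤-len {v = v} (d-diag , _) here = ≤-reflexive (d-diag v)
  lipschitz⇒≤-len {u = u} {v} lip@(_ , d-step) (step {w = x} ux w) =
    ≤-trans (d-step u x v ux) (s≤s (lipschitz⇒≤-len lip w))

  Unavoidable : ℕ → Fin n → Fin n → Edge G → Set
  Unavoidable zero    u v e = u ≢ v
  Unavoidable (suc k) u v e =
    u ≢ v × (∀ x (ux : Adj G u x) → edgeOf G u x ux ≡ e ⊎ Unavoidable k x v e)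

  unavoidable? : ∀ k u v e → Dec (Unavoidable k u v e)
  unavoidable? zero    u v e = ¬? (u ≟ v)
  unavoidable? (suc k) u v e = ¬? (u ≟ v) ×-dec
    all? λ x → ∀-adj? λ ux → (edgeOf G u x ux ≟ᴱ e) ⊎-dec unavoidable? k x v e
    where
    ∀-adj? : ∀ {x} {P : Adj G u x → Set} → (∀ ux → Dec (P ux)) → Dec (∀ ux → P ux)
    ∀-adj? {x} P? with adj G u x
    ... | false = yes λ ()
    ... | true  = map′ (λ { p refl → p }) (λ ∀p → ∀p refl) (P? refl)

  unavoidable-∈ : ∀ {k u v e} → Unavoidable k u v e →
                  (w : Walk G u v) → len w ≤ k → e ∈ edges w
  unavoidable-∈ {zero}  u≢u       here        _         = ⊥-elim (u≢u refl)
  unavoidable-∈ {suc _} (u≢u , _) here        _         = ⊥-elim (u≢u refl)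
  unavoidable-∈ {suc _} (_ , via) (step ux w) (s≤s |w|≤k) with via _ ux
  ... | inj₁ eq      = here (sym eq)
  ... | inj₂ unavoid = there (unavoidable-∈ unavoid w |w|≤k)

  walkOfLength : ℕ → ∀ u v → Maybe (Walk G u v)
  walkOfLength zero u v with u ≟ v
  ... | yes refl = just here
  ... | no _     = nothing
  walkOfLength (suc k) u v = head (mapMaybe via (allFin n))
    where
    via : Fin n → Maybe (Walk G u v)
    via x with adj G u x in ux
    ... | true  = Maybe.map (step ux) (walkOfLength k x v)
    ... | false = nothing

  shortestWalk : ∀ u v → Maybe (Walk G u v)
  shortestWalk u v = head (mapMaybe (λ k → walkOfLength k u v) (upTo n))

  Routable : Set
  Routable = ∀ u v → Is-just (shortestWalk u v)

  routable? : Dec Routable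
  routable? = all? λ u → all? λ v → MaybeAny.dec (λ _ → yes tt) (shortestWalk u v)

  -- Matching on the search result rather than using to-witness (ok u v) keeps the proof ok,
  -- which re-runs every search, out of the evaluation of walkBetween.
  walkBetween : Routable → ∀ u v → Walk G u v
  walkBetween ok u v with shortestWalk u v | ok u v
  ... | just w | _ = w

  ColourSeparated : Edge G → Edge G → Set
  ColourSeparated e f = ∀ c → StronglyRainbowConnected G c → c e ≢ c f

  separated-clique⇒¬listSRC : (K : Fin m → Edge G) →
    (∀ i j → i ≢ j → ColourSeparated (K i) (K j)) → r < m → ¬ ListSRC G r
  separated-clique⇒¬listSRC {r = r} K sep r<m listSRC
    with c , c<r , src ← listSRC (λ _ k → k < r) (λ _ → toℕ , toℕ-injective , toℕ<n)
    with i , j , i<j , same ← pigeonhole r<m (λ i → fromℕ< (c<r (K i)))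
    = sep i j (<⇒≢ i<j) c src (fromℕ<-injective _ _ (c<r (K i)) (c<r (K j)) same)

  module Routes (route : ∀ u v → Walk G u v) where

    AreShortest : Set
    AreShortest = (∀ u v → IsPath (route u v)) × Lipschitz (λ u v → len (route u v))

    areShortest? : Dec AreShortest
    areShortest? = (all? λ u → all? λ v → UniqueDec.unique? _≟_ (vertices (route u v)))
                   ×-dec lipschitz? _

    geodesic : AreShortest → ∀ u v → IsGeodesic (route u v)
    geodesic (paths , lip) u v = paths u v , λ w _ → lipschitz⇒≤-len lip w

    routeEdges : List (List (Edge G))
    routeEdges = map (λ (u , v) → edges (route u v)) (cartesianProduct (allFin n) (allFin n))

    ∈-routeEdges : ∀ u v → edges (route u v) ∈ routeEdges
    ∈-routeEdges u v = ∈-map⁺ (λ (u , v) → edges (route u v))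
                               (∈-cartesianProduct⁺ (∈-allFin u) (∈-allFin v))

    Conflict : Rel (Edge G) 0ℓ
    Conflict = CoOccur routeEdges

    -- Point-free, so that within one evaluation routeEdges is computed once and shared
    -- by all the conflict tests.
    conflict? : Decidable Conflict
    conflict? = coOccur? _≟ᴱ_ routeEdges

    separating⇒src : AreShortest → (c : EdgeColouring G) →
      (∀ {e f} → e ≢ f → Conflict e f → c e ≢ c f) → StronglyRainbowConnected G c
    separating⇒src shortest c sep u v = route u v , geodesic shortest u v ,
      unique-map⁺ (λ e∈ f∈ e≢f → sep e≢f (Any.map (λ { refl → e∈ , f∈ }) (∈-routeEdges u v)))
                  (path⇒edges-unique _ (proj₁ shortest u v))

    open GreedyListColouring _≟ᴱ_ conflict? (coOccur-sym routeEdges) public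

    degenerate⇒listSRC : AreShortest → Degenerate r (reverse edgeList) → ListSRC G r
    degenerate⇒listSRC shortest deg L L-size =
      colour , from-lists ∘ ∈-all , separating⇒src shortest colour (proper (∈-all _) (∈-all _))
      where
      open ProperListColouring (choosable L L-size (reverse edgeList) deg)

      ∈-all : ∀ e → e ∈ reverse edgeList
      ∈-all e = reverse⁺ (∈-edgeList e)

    ForcedPair : Rel (Edge G) 0ℓ
    ForcedPair e f =
      e ≢ f × ∃₂ λ u v → Unavoidable (len (route u v)) u v e × Unavoidable (len (route u v)) u v f

    forcedPair? : Decidable ForcedPair
    forcedPair? e f = ¬? (e ≟ᴱ f) ×-dec any? λ u → any? λ v →
      unavoidable? (len (route u v)) u v e ×-dec unavoidable? (len (route u v)) u v f

    forced⇒separated : AreShortest → ∀ {e f} → ForcedPair e f → ColourSeparated e f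
    forced⇒separated shortest (e≢f , u , v , e-forced , f-forced) c src ce≡cf
      with w , (_ , w-shortest) , rainbow ← src u v
      = e≢f (unique-map⇒injective rainbow
               (unavoidable-∈ e-forced w |w|≤) (unavoidable-∈ f-forced w |w|≤) ce≡cf)
      where
      |w|≤ : len w ≤ len (route u v)
      |w|≤ = w-shortest (route u v) (proj₁ shortest u v)

    SrcℓCertificate : (K : Fin m → Edge G) → Set
    SrcℓCertificate {m} K = AreShortest × Degenerate m (reverse edgeList) ×
                            (∀ i j → i ≢ j → ForcedPair (K i) (K j))

    srcℓCertificate? : (K : Fin m → Edge G) → Dec (SrcℓCertificate K)
    srcℓCertificate? {m} K = areShortest? ×-dec degenerate? m (reverse edgeList) ×-dec
      all? λ i → all? λ j → ¬? (i ≟ j) →-dec forcedPair? (K i) (K j)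

    certificate⇒isSrcℓ : (K : Fin m → Edge G) → SrcℓCertificate K → IsSrcℓ G m
    certificate⇒isSrcℓ K (shortest , deg , forced) =
      degenerate⇒listSRC shortest deg ,
      λ r → separated-clique⇒¬listSRC K λ i j i≢j → forced⇒separated shortest (forced i j i≢j)

  edge : ∀ u v {u<v : True (u <ᶠ? v)} {uv : True (adj G u v Bool.≟ true)} → Edge G
  edge u v {u<v} {uv} = u , v , toWitness u<v , toWitness uv

spanning? : (H G : Graph n) → Dec (SpanningSubgraph H G)
spanning? H G = all? λ u → all? λ v → (adj H u v Bool.≟ true) →-dec (adj G u v Bool.≟ true)

fromEdges : List (Fin n × Fin n) → Graph n
fromEdges {n} es = record
  { adj        = λ u v → does (linked? u v)
  ; adj-sym    = λ u v → does-⇔ (mk⇔ swap swap) (linked? u v) (linked? v u)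
  ; adj-irrefl = λ u → dec-false (linked? u u) λ (u≢u , _) → u≢u refl
  }
  where
  Linked : Fin n → Fin n → Set
  Linked u v = u ≢ v × ((u , v) ∈ es ⊎ (v , u) ∈ es)

  linked? : ∀ u v → Dec (Linked u v)
  linked? u v = ¬? (u ≟ v) ×-dec (Any.any? ((u , v) ≟ₚ_) es ⊎-dec Any.any? ((v , u) ≟ₚ_) es)
    where
    _≟ₚ_ : DecidableEquality (Fin n × Fin n)
    _≟ₚ_ = ≡-dec _≟_ _≟_

  swap : ∀ {u v} → Linked u v → Linked v u
  swap (u≢v , uv∈) = ≢-sym u≢v , Sum.swap uv∈

G : Graph 8
G = fromEdges ((# 0 , # 2) ∷ (# 1 , # 4) ∷ (# 2 , # 7) ∷ (# 3 , # 5) ∷ (# 3 , # 7) ∷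
               (# 4 , # 6) ∷ (# 4 , # 7) ∷ (# 5 , # 6) ∷ (# 5 , # 7) ∷ (# 6 , # 7) ∷ [])

H : Graph 8
H = fromEdges ((# 0 , # 2) ∷ (# 1 , # 4) ∷ (# 2 , # 7) ∷ (# 3 , # 5) ∷
               (# 4 , # 6) ∷ (# 4 , # 7) ∷ (# 5 , # 6) ∷ (# 5 , # 7) ∷ (# 6 , # 7) ∷ [])

G-routable : Routable G
G-routable = from-yes (routable? G)

H-routable : Routable H
H-routable = from-yes (routable? H)

srcℓ-G : IsSrcℓ G 5
srcℓ-G = certificate⇒isSrcℓ K (from-yes (srcℓCertificate? K))
  where
  open Routes G (walkBetween G G-routable)

  K : Fin 5 → Edge G
  K = Vec.lookup (edge G (# 0) (# 2) ∷ edge G (# 1) (# 4) ∷ edge G (# 2) (# 7) ∷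
                  edge G (# 3) (# 7) ∷ edge G (# 4) (# 7) ∷ [])

srcℓ-H : IsSrcℓ H 4
srcℓ-H = certificate⇒isSrcℓ K (from-yes (srcℓCertificate? K))
  where
  open Routes H (walkBetween H H-routable)

  K : Fin 4 → Edge H
  K = Vec.lookup (edge H (# 0) (# 2) ∷ edge H (# 1) (# 4) ∷ edge H (# 2) (# 7) ∷
                  edge H (# 3) (# 5) ∷ [])

theorem2p2 : Σ ℕ λ n → Σ (Graph n) λ G → Σ (Graph n) λ H →
    Connected G × Connected H × SpanningSubgraph H G ×
    Σ ℕ λ a → Σ ℕ λ b → IsSrcℓ G a × IsSrcℓ H b × b < a
theorem2p2 =
  8 , G , H , walkBetween G G-routable , walkBetween H H-routable , from-yes (spanning? H G) ,
  5 , 4 , srcℓ-G , srcℓ-H , n<1+n 4
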